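{- Let $Z$ be a set, $\mathcal{Y}\subseteq\mathcal{P}(Z)$, let $\mathcal{A}$ be a finite set of pairwise disjoint nonempty subsets of $Z$ with union $Z$, totally ordered by $<$, and let $\mu:\mathcal{Y}\to\mathcal{P}(Z)$ satisfy $(\mu\mathcal{A})$. Let $\mathcal{Z}=\langle\mathcal{X},\prec\rangle$ be a $\mathcal{Y}$-smooth preferential structure over $Z$ representing $\mu$, i.e. $\mu(X)=\mu_{\mathcal{Z}}(X)$ for all $X\in\mathcal{Y}$. Suppose that $\langle x,i\rangle\prec\langle y,j\rangle$ implies $rg(x)\le rg(y)$. Define $\mathcal{Z}':=\langle\mathcal{X},\sqsubset\rangle$ where $\langle x,i\rangle\sqsubset\langle y,j\rangle$ iff $\langle x,i\rangle\prec\langle y,j\rangle$ or $rg(x)<rg(y)$. Then $\mathcal{Z}'$ is $\mathcal{A}$-ranked, $\mathcal{Z}'$ is $\mathcal{Y}$-smooth, and $\mu_{\mathcal{Z}}(X)=\mu_{\mathcal{Z}'}(X)$ for all $X\in\mathcal{Y}$. In addition, if $\prec$ is free from cycles, so is $\sqsubset$, and if $\prec$ is transitive, so is $\sqsubset$.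
   Context: A preferential structure over $Z$ is a pair $\langle\mathcal{X},\prec\rangle$ with $\mathcal{X}$ a set of pairs $\langle x,i\rangle$, $x\in Z$, and $\prec$ a binary relation on $\mathcal{X}$; $\mu_{\mathcal{Z}}(X):=\{x\in X:\exists\langle x,i\rangle\in\mathcal{X}\ \neg\exists\langle x',i'\rangle\in\mathcal{X}(x'\in X\wedge\langle x',i'\rangle\prec\langle x,i\rangle)\}$. $\mathcal{Y}$-smooth: whenever $x\in X\in\mathcal{Y}$ and $\langle x,i\rangle\in\mathcal{X}$, either there is no $\langle x',i'\rangle\in\mathcal{X}$ with $x'\in X$ and $\langle x',i'\rangle\prec\langle x,i\rangle$, or there is $\langle x',i'\rangle\in\mathcal{X}$ with $x'\in X$, $\langle x',i'\rangle\prec\langle x,i\rangle$, such that there is no $\langle x'',i''\rangle\in\mathcal{X}$ with $x''\in X$ and $\langle x'',i''\rangle\prec\langle x',i'\rangle$. $rg(x)$ is the unique $A\in\mathcal{A}$ containing $x$. $\mathcal{A}$-ranked: $rg(x)<rg(x')$ implies $\langle x,i\rangle$ is below $\langle x',i'\rangle$ for all copies in $\mathcal{X}$. $(\mu\mathcal{A})$: if $X\in\mathcal{Y}$, $A,A'\in\mathcal{A}$, $A<A'$, $X\cap A\neq\emptyset$, $X\cap A'\neq\emptyset$, then $\mu(X)\cap A'=\emptyset$. A relation is free from cycles if there is no finite chain $a_0\prec a_1\prec\dots\prec a_n=a_0$ with $n\ge1$. -}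

module Defs where

open import Level using (0ℓ)
open import Data.Product using (Σ; ∃; _×_; _,_; proj₁; proj₂)
open import Data.Sum using (_⊎_)
open import Data.Nat using (ℕ)
open import Data.Fin using (Fin; _<_)
open import Relation.Nullary using (¬_)
open import Relation.Unary using (Pred)
open import Relation.Binary using (Rel)
open import Relation.Binary.PropositionalEquality using (_≡_)
open import Relation.Binary.Construct.Closure.Transitive using (TransClosure)

-- A preferential structure over Z: an index type I, the set 𝒳 ⊆ Z × I of
-- copies ⟨x,i⟩, and a binary relation on copies.
record PrefStr (Z : Set) : Set₁ where
  field
    I   : Set
    𝒳   : Pred (Z × I) 0ℓ
    _≺_ : Rel (Z × I) 0ℓ

module _ {Z : Set} {I : Set} (𝒳 : Pred (Z × I) 0ℓ) (_≺_ : Rel (Z × I) 0ℓ) where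

  BelowIn : Pred Z 0ℓ → Z × I → Set
  BelowIn X p = Σ (Z × I) λ q → 𝒳 q × X (proj₁ q) × q ≺ p

  μZ : Pred Z 0ℓ → Pred Z 0ℓ
  μZ X x = X x × Σ I λ i → 𝒳 (x , i) × ¬ BelowIn X (x , i)

  Smooth : Pred (Pred Z 0ℓ) 0ℓ → Set₁
  Smooth 𝒴 = ∀ (X : Pred Z 0ℓ) → 𝒴 X → ∀ x i → X x → 𝒳 (x , i) →
    (¬ BelowIn X (x , i))
    ⊎ (Σ (Z × I) λ q → 𝒳 q × X (proj₁ q) × q ≺ (x , i) × ¬ BelowIn X q)

  _≺𝒳_ : Rel (Z × I) 0ℓ
  p ≺𝒳 q = 𝒳 p × 𝒳 q × p ≺ q

  CycleFree : Set
  CycleFree = ∀ a → ¬ TransClosure _≺𝒳_ a a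

  Transitive𝒳 : Set
  Transitive𝒳 = ∀ p q r → 𝒳 p → 𝒳 q → 𝒳 r → p ≺ q → q ≺ r → p ≺ r

-- 𝒜 = {A 0, …, A (n-1)} given as a Fin n-indexed family; the total order
-- on 𝒜 is transported from the order on Fin n.
record Partition (Z : Set) : Set₁ where
  field
    n        : ℕ
    A        : Fin n → Pred Z 0ℓ
    nonempty : ∀ k → ∃ λ z → A k z
    disjoint : ∀ k l z → A k z → A l z → k ≡ l
    cover    : ∀ z → ∃ λ k → A k z

  rg : Z → Fin n
  rg z = proj₁ (cover z)

  μ𝒜 : Pred (Pred Z 0ℓ) 0ℓ → (Pred Z 0ℓ → Pred Z 0ℓ) → Set₁
  μ𝒜 𝒴 μ = ∀ (X : Pred Z 0ℓ) → 𝒴 X → ∀ k l → k < l →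
    (∃ λ x → X x × A k x) → (∃ λ x → X x × A l x) →
    ∀ x → μ X x → ¬ A l x

  Ranked : {I : Set} → Pred (Z × I) 0ℓ → Rel (Z × I) 0ℓ → Set
  Ranked 𝒳 R = ∀ p q → 𝒳 p → 𝒳 q → rg (proj₁ p) < rg (proj₁ q) → R p q

  rankExt : {I : Set} → Rel (Z × I) 0ℓ → Rel (Z × I) 0ℓ
  rankExt R p q = R p q ⊎ rg (proj₁ p) < rg (proj₁ q)

module Submission where

-- The extension ⊏ of ≺ only adds the pairs ⟨x,i⟩ ⊏ ⟨y,j⟩ with
-- rg(x) < rg(y), so it is 𝒜-ranked by definition.  The heart of the matter
-- is that these new pairs never destroy minimality inside a set X ∈ 𝒴: by
-- (μ𝒜) together with μ = μ_𝒵, an element of μ_𝒵(X) lies in the lowest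
-- rank met by X, so no element of X has a strictly smaller rank.  Hence a
-- copy that is ≺-minimal in X is also ⊏-minimal in X; conversely ⊏ ⊇ ≺.
-- This yields μ_𝒵 = μ_𝒵' on 𝒴, and smoothness transfers because every
-- ≺-minimal witness supplied by 𝒴-smoothness of 𝒵 stays ⊏-minimal.
-- For cycles and transitivity we use that ≺ never decreases rank: a
-- ⊏-chain is either a pure ≺-chain or strictly increases rank, so a
-- ⊏-cycle yields a ≺-cycle; transitivity is a four-case check.

open import Defs
open import Level using (0ℓ)
open import Data.Product using (_×_; _,_; proj₁; proj₂; ∃)
open import Data.Sum using (_⊎_; inj₁; inj₂)
open import Data.Fin using (_≤_; _<_)
open import Relation.Nullary using (¬_)
open import Relation.Unary using (Pred; _≐_)
open import Relation.Binary using (Rel)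
open import Relation.Binary.PropositionalEquality using (refl)
open import Relation.Binary.Construct.Closure.Transitive using (TransClosure; [_]; _∷_)
open import Axiom.ExcludedMiddle using (ExcludedMiddle)
import Data.Nat.Properties as ℕ

module RankExtension {Z : Set} (𝒜 : Partition Z)
                     {I : Set} (𝒳 : Pred (Z × I) 0ℓ) (_≺_ : Rel (Z × I) 0ℓ) where

  open Partition 𝒜 using (rg; cover; μ𝒜; Ranked; rankExt)

  _⊏_ : Rel (Z × I) 0ℓ
  _⊏_ = rankExt _≺_

  ⊏-ranked : Ranked 𝒳 _⊏_
  ⊏-ranked _ _ _ _ rg<rg = inj₂ rg<rg

  RankMonotone : Rel (Z × I) 0ℓ → Set
  RankMonotone R = ∀ p q → 𝒳 p → 𝒳 q → R p q → rg (proj₁ p) ≤ rg (proj₁ q)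

  chain-rank-≤ : ∀ {R} → RankMonotone R →
    ∀ {a b} → TransClosure (_≺𝒳_ 𝒳 R) a b → rg (proj₁ a) ≤ rg (proj₁ b)
  chain-rank-≤ mono [ (𝒳a , 𝒳b , aRb) ]      = mono _ _ 𝒳a 𝒳b aRb
  chain-rank-≤ mono ((𝒳a , 𝒳b , aRb) ∷ rest) =
    ℕ.≤-trans (mono _ _ 𝒳a 𝒳b aRb) (chain-rank-≤ mono rest)

  below-⊏ : ∀ X p → BelowIn 𝒳 _⊏_ X p →
    BelowIn 𝒳 _≺_ X p ⊎ (∃ λ y → X y × rg y < rg (proj₁ p))
  below-⊏ X p (q , 𝒳q , Xq , inj₁ q≺p)     = inj₁ (q , 𝒳q , Xq , q≺p)
  below-⊏ X p (q , 𝒳q , Xq , inj₂ rg<rg)   = inj₂ (proj₁ q , Xq , rg<rg)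

  below-≺⇒below-⊏ : ∀ X p → BelowIn 𝒳 _≺_ X p → BelowIn 𝒳 _⊏_ X p
  below-≺⇒below-⊏ X p (q , 𝒳q , Xq , q≺p) = q , 𝒳q , Xq , inj₁ q≺p

  module Minimality (𝒴 : Pred (Pred Z 0ℓ) 0ℓ) where

    LowestRank : Set₁
    LowestRank = ∀ X → 𝒴 X → ∀ x y → μZ 𝒳 _≺_ X x → X y → ¬ rg y < rg x

    μ𝒜⇒lowestRank : ∀ μ → μ𝒜 𝒴 μ →
      (∀ X → 𝒴 X → μ X ≐ μZ 𝒳 _≺_ X) → LowestRank
    μ𝒜⇒lowestRank μ hμ𝒜 represents X 𝒴X x y x∈μZ Xy rg<rg =
      hμ𝒜 X 𝒴X (rg y) (rg x) rg<rg (y , Xy , proj₂ (cover y))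
        (x , proj₁ x∈μZ , proj₂ (cover x)) x
        (proj₂ (represents X 𝒴X) x∈μZ) (proj₂ (cover x))

    minimal-stays-minimal : LowestRank → ∀ X → 𝒴 X → ∀ x i → X x →
      𝒳 (x , i) → ¬ BelowIn 𝒳 _≺_ X (x , i) → ¬ BelowIn 𝒳 _⊏_ X (x , i)
    minimal-stays-minimal lowest X 𝒴X x i Xx 𝒳xi ≺-minimal below
      with below-⊏ X (x , i) below
    ... | inj₁ ≺-below               = ≺-minimal ≺-below
    ... | inj₂ (y , Xy , rg<rg) =
      lowest X 𝒴X x y (Xx , i , 𝒳xi , ≺-minimal) Xy rg<rg

    μZ-≐ : LowestRank → ∀ X → 𝒴 X → μZ 𝒳 _≺_ X ≐ μZ 𝒳 _⊏_ X
    μZ-≐ lowest X 𝒴X = to , from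
      where
      to : ∀ {x} → μZ 𝒳 _≺_ X x → μZ 𝒳 _⊏_ X x
      to {x} (Xx , i , 𝒳xi , ≺-minimal) =
        Xx , i , 𝒳xi , minimal-stays-minimal lowest X 𝒴X x i Xx 𝒳xi ≺-minimal
      from : ∀ {x} → μZ 𝒳 _⊏_ X x → μZ 𝒳 _≺_ X x
      from {x} (Xx , i , 𝒳xi , ⊏-minimal) =
        Xx , i , 𝒳xi , λ below → ⊏-minimal (below-≺⇒below-⊏ X (x , i) below)

    ⊏-smooth : LowestRank → Smooth 𝒳 _≺_ 𝒴 → Smooth 𝒳 _⊏_ 𝒴
    ⊏-smooth lowest smooth X 𝒴X x i Xx 𝒳xi with smooth X 𝒴X x i Xx 𝒳xi
    ... | inj₁ ≺-minimal =
      inj₁ (minimal-stays-minimal lowest X 𝒴X x i Xx 𝒳xi ≺-minimal)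
    ... | inj₂ ((y , j) , 𝒳yj , Xy , yj≺xi , ≺-minimal) =
      inj₂ ((y , j) , 𝒳yj , Xy , inj₁ yj≺xi ,
            minimal-stays-minimal lowest X 𝒴X y j Xy 𝒳yj ≺-minimal)

  module Monotone (mono : RankMonotone _≺_) where

    ⊏-chain : ∀ {a b} → TransClosure (_≺𝒳_ 𝒳 _⊏_) a b →
      TransClosure (_≺𝒳_ 𝒳 _≺_) a b ⊎ rg (proj₁ a) < rg (proj₁ b)
    ⊏-chain [ (𝒳a , 𝒳b , inj₁ a≺b) ]   = inj₁ [ (𝒳a , 𝒳b , a≺b) ]
    ⊏-chain [ (𝒳a , 𝒳b , inj₂ rg<rg) ] = inj₂ rg<rg
    ⊏-chain ((𝒳a , 𝒳b , inj₁ a≺b) ∷ rest) with ⊏-chain rest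
    ... | inj₁ chain = inj₁ ((𝒳a , 𝒳b , a≺b) ∷ chain)
    ... | inj₂ rg<rg = inj₂ (ℕ.≤-<-trans (mono _ _ 𝒳a 𝒳b a≺b) rg<rg)
    ⊏-chain ((𝒳a , 𝒳b , inj₂ rg<rg) ∷ rest) with ⊏-chain rest
    ... | inj₁ chain  = inj₂ (ℕ.<-≤-trans rg<rg (chain-rank-≤ mono chain))
    ... | inj₂ rg<rg' = inj₂ (ℕ.<-trans rg<rg rg<rg')

    -- a ⊏-cycle would be a ≺-cycle, since rank cannot strictly increase
    -- along a cycle
    ⊏-cycleFree : CycleFree 𝒳 _≺_ → CycleFree 𝒳 _⊏_
    ⊏-cycleFree cycleFree a cycle with ⊏-chain cycle
    ... | inj₁ ≺-cycle = cycleFree a ≺-cycle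
    ... | inj₂ rg<rg   = ℕ.<-irrefl refl rg<rg

    ⊏-transitive : Transitive𝒳 𝒳 _≺_ → Transitive𝒳 𝒳 _⊏_
    ⊏-transitive trans p q r 𝒳p 𝒳q 𝒳r (inj₁ p≺q) (inj₁ q≺r) =
      inj₁ (trans p q r 𝒳p 𝒳q 𝒳r p≺q q≺r)
    ⊏-transitive trans p q r 𝒳p 𝒳q 𝒳r (inj₁ p≺q) (inj₂ rg<rg) =
      inj₂ (ℕ.≤-<-trans (mono p q 𝒳p 𝒳q p≺q) rg<rg)
    ⊏-transitive trans p q r 𝒳p 𝒳q 𝒳r (inj₂ rg<rg) (inj₁ q≺r) =
      inj₂ (ℕ.<-≤-trans rg<rg (mono q r 𝒳q 𝒳r q≺r))
    ⊏-transitive trans p q r 𝒳p 𝒳q 𝒳r (inj₂ rg<rg) (inj₂ rg<rg') =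
      inj₂ (ℕ.<-trans rg<rg rg<rg')

-- Fact 3.11.
fact3p11 : ExcludedMiddle 0ℓ →
    (Z : Set) (𝒴 : Pred (Pred Z 0ℓ) 0ℓ) (𝒜 : Partition Z)
    (μ : Pred Z 0ℓ → Pred Z 0ℓ) → Partition.μ𝒜 𝒜 𝒴 μ →
    (𝒵 : PrefStr Z) →
    Smooth (PrefStr.𝒳 𝒵) (PrefStr._≺_ 𝒵) 𝒴 →
    (∀ X → 𝒴 X → μ X ≐ μZ (PrefStr.𝒳 𝒵) (PrefStr._≺_ 𝒵) X) →
    (∀ p q → PrefStr.𝒳 𝒵 p → PrefStr.𝒳 𝒵 q → PrefStr._≺_ 𝒵 p q →
    Partition.rg 𝒜 (proj₁ p) ≤ Partition.rg 𝒜 (proj₁ q)) →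
    Partition.Ranked 𝒜 (PrefStr.𝒳 𝒵) (Partition.rankExt 𝒜 (PrefStr._≺_ 𝒵))
    × Smooth (PrefStr.𝒳 𝒵) (Partition.rankExt 𝒜 (PrefStr._≺_ 𝒵)) 𝒴
    × (∀ X → 𝒴 X → μZ (PrefStr.𝒳 𝒵) (PrefStr._≺_ 𝒵) X
    ≐ μZ (PrefStr.𝒳 𝒵) (Partition.rankExt 𝒜 (PrefStr._≺_ 𝒵)) X)
    × (CycleFree (PrefStr.𝒳 𝒵) (PrefStr._≺_ 𝒵) →
    CycleFree (PrefStr.𝒳 𝒵) (Partition.rankExt 𝒜 (PrefStr._≺_ 𝒵)))
    × (Transitive𝒳 (PrefStr.𝒳 𝒵) (PrefStr._≺_ 𝒵) →
    Transitive𝒳 (PrefStr.𝒳 𝒵) (Partition.rankExt 𝒜 (PrefStr._≺_ 𝒵)))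
fact3p11 _ Z 𝒴 𝒜 μ hμ𝒜 𝒵 smooth represents mono =
  ⊏-ranked , ⊏-smooth lowest smooth , μZ-≐ lowest
  , ⊏-cycleFree , ⊏-transitive
  where
  open PrefStr 𝒵
  open RankExtension 𝒜 𝒳 _≺_
  open Minimality 𝒴
  open Monotone mono

  lowest : LowestRank
  lowest = μ𝒜⇒lowestRank μ hμ𝒜 represents
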